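{- Let $k\ge 2$. Let $f^i_{k,n}$ and $l^i_{k,n}$ ($1\le i\le k$) be the $k$ sequences of generalized order-$k$ Fibonacci numbers and Lucas numbers defined in the context. For $n\ge 0$ let $F_n^{\sim}$ be the $k\times k$ matrix whose $(r,i)$ entry is $f^i_{k,n-r+1}$ and $L_n^{\sim}$ the $k\times k$ matrix whose $(r,i)$ entry is $l^i_{k,n-r+1}$ ($1\le r,i\le k$). Then for every integer $n\ge 0$, $$L_n^{\sim}=F_n^{\sim}L_0^{\sim}.$$
   Context: $k$ sequences of generalized order-$k$ Fibonacci numbers (with all coefficients equal to $1$): for $1\le i\le k$, $f^i_{k,n}=1$ if $1-k\le n\le 0$ and $i=1-n$, $f^i_{k,n}=0$ if $1-k\le n\le 0$ and $i\neq 1-n$, and $f^i_{k,n}=\sum_{j=1}^k f^i_{k,n-j}$ for $n\ge 1$. $k$ sequences of generalized order-$k$ Lucas numbers: for $1\le i\le k$ and $1-k\le n\le 0$, $l^i_{k,n}=-i$ if $i-n<k$, $l^i_{k,n}=i-2n$ if $i-n=k$, $l^i_{k,n}=k-i-1$ if $i-n>k$; and $l^i_{k,n}=\sum_{j=1}^k l^i_{k,n-j}$ for $n\ge 1$. -}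

module Defs where

open import Data.Nat as ℕ using (ℕ; zero; suc)
open import Data.Integer as ℤ using (ℤ; +_; _+_; _-_; _*_; -_; ∣_∣)
open import Data.Fin using (Fin; toℕ)
open import Data.List using (List; []; _∷_; take; map; foldr; allFin)
open import Data.Bool using (if_then_else_)
open import Relation.Nullary.Decidable using (⌊_⌋; yes; no)

sumℤ : List ℤ → ℤ
sumℤ = foldr _+_ (+ 0)

-- The index i ∈ {1..k} is represented by (i : Fin k), with value toℕ i + 1.
ival : ∀ {k} → Fin k → ℤ
ival i = + suc (toℕ i)

fibInit : (k : ℕ) → Fin k → ℤ → ℤ
fibInit k i n = if ⌊ ival i ℤ.≟ (+ 1 - n) ⌋ then + 1 else + 0

lucInit : (k : ℕ) → Fin k → ℤ → ℤ
lucInit k i n =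
  if ⌊ (ival i - n) ℤ.<? + k ⌋ then - ival i
  else if ⌊ (ival i - n) ℤ.≟ + k ⌋ then ival i - (+ 2) * n
  else + k - ival i - + 1

-- Generic order-k linear recurrence s_n = Σ_{j=1}^k s_{n-j} (n ≥ 1),
-- with given initial values on 1-k ≤ n ≤ 0.
-- Internally we use the shifted index m = n + k - 1 ∈ ℕ.
-- hist k init m = [s_m', s_{m'-1}, ..., s_{1-k}] where m' = m + 1 - k (newest first).
hist : (k : ℕ) → (ℤ → ℤ) → ℕ → List ℤ
hist k init zero = init (+ 1 - + k) ∷ []
hist k init (suc m) with suc m ℕ.<? k
... | yes _ = init (+ suc m + + 1 - + k) ∷ hist k init m
... | no _ = sumℤ (take k (hist k init m)) ∷ hist k init m

headOr0 : List ℤ → ℤ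
headOr0 [] = + 0
headOr0 (x ∷ _) = x

-- The sequence at integer index n (meaningful for n ≥ 1-k; value 0 below that).
recSeq : (k : ℕ) → (ℤ → ℤ) → ℤ → ℤ
recSeq k init n with (n + + k - + 1) ℤ.<? + 0
... | yes _ = + 0
... | no _ = headOr0 (hist k init ∣ n + + k - + 1 ∣)

fib : (k : ℕ) → Fin k → ℤ → ℤ
fib k i = recSeq k (fibInit k i)

luc : (k : ℕ) → Fin k → ℤ → ℤ
luc k i = recSeq k (lucInit k i)

Mat : ℕ → Set
Mat k = Fin k → Fin k → ℤ

_⊗_ : ∀ {k} → Mat k → Mat k → Mat k
(A ⊗ B) r c = sumℤ (map (λ t → A r t * B t c) (allFin _))

Ftil : (k : ℕ) → ℕ → Mat k
Ftil k n r i = fib k i (+ n - ival r + + 1)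

Ltil : (k : ℕ) → ℕ → Mat k
Ltil k n r i = luc k i (+ n - ival r + + 1)

-- Entrywise the claim reads  l^i_{k,x} = Σ_{t=1}^{k} f^t_{k,x} · l^i_{k,1-t}
-- for x = n - r + 1.  This is an instance of a general fact about the
-- order-k recurrence s_x = s_{x-1} + ... + s_{x-k}: the k Fibonacci
-- sequences f^1..f^k form a basis of its solution space, the coordinates
-- being the initial values,  s_x = Σ_t f^t_{k,x} · s_{1-t}  (needs k ≥ 1).

module Submission where

open import Defs
open import Data.Nat using (ℕ; _≤_)
open import Relation.Binary.PropositionalEquality using (_≡_)

open import Data.Nat as ℕ using (zero; suc; _∸_; _<_; s≤s; z≤n)
import Data.Nat.Properties as ℕP
open import Data.Integer as ℤ using (ℤ; +_; _+_; _-_; _*_; ∣_∣)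
import Data.Integer.Properties as ℤP
open import Data.Integer.Tactic.RingSolver using (solve-∀)
open import Data.Fin using (Fin; toℕ; fromℕ<) renaming (zero to fzero; suc to fsuc)
import Data.Fin.Properties as FP
open import Data.List using (List; []; _∷_; take; map; allFin; tabulate; downFrom)
import Data.List.Properties as LP
open import Relation.Nullary.Decidable using (yes; no)
open import Relation.Binary.PropositionalEquality
  using (_≢_; refl; sym; trans; cong; cong₂; subst; module ≡-Reasoning)
open import Data.Empty using (⊥-elim)
open import Algebra.Properties.Semiring.Sum ℤP.+-*-semiring
  using (sum; sum-cong-≗; sum-replicate-zero; ∑-distrib-+)

sumℤ-allFin : ∀ {n} (g : Fin n → ℤ) → sumℤ (map g (allFin n)) ≡ sum g
sumℤ-allFin g = trans (cong sumℤ (LP.map-tabulate (λ t → t) g)) (sumℤ-tabulate g)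
  where
  sumℤ-tabulate : ∀ {n} (g : Fin n → ℤ) → sumℤ (tabulate g) ≡ sum g
  sumℤ-tabulate {zero} g = refl
  sumℤ-tabulate {suc n} g = cong (_+_ (g fzero)) (sumℤ-tabulate (λ t → g (fsuc t)))

sum-select : ∀ {n} (w c : Fin n → ℤ) (t₀ : Fin n) →
  w t₀ ≡ + 1 → (∀ t → t ≢ t₀ → w t ≡ + 0) → sum (λ t → w t * c t) ≡ c t₀
sum-select {suc n} w c fzero w₀≡1 w≡0 = begin
    w fzero * c fzero + sum (λ t → w (fsuc t) * c (fsuc t))
  ≡⟨ cong₂ _+_ (cong (_* c fzero) w₀≡1) rest≡0 ⟩
    + 1 * c fzero + + 0
  ≡⟨ trans (ℤP.+-identityʳ _) (ℤP.*-identityˡ _) ⟩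
    c fzero
  ∎
  where
  open ≡-Reasoning
  rest≡0 : sum (λ t → w (fsuc t) * c (fsuc t)) ≡ + 0
  rest≡0 = trans (sum-cong-≗ (λ t → cong (_* c (fsuc t)) (w≡0 (fsuc t) λ ())))
                 (trans (sum-cong-≗ (λ t → ℤP.*-zeroˡ (c (fsuc t)))) (sum-replicate-zero n))
sum-select w c (fsuc t₀) w₀≡1 w≡0 = begin
    w fzero * c fzero + sum (λ t → w (fsuc t) * c (fsuc t))
  ≡⟨ cong₂ _+_ (cong (_* c fzero) (w≡0 fzero λ ()))
               (sum-select (λ t → w (fsuc t)) (λ t → c (fsuc t)) t₀ w₀≡1
                  (λ t t≢t₀ → w≡0 (fsuc t) (λ eq → t≢t₀ (FP.suc-injective eq)))) ⟩
    + 0 * c fzero + c (fsuc t₀)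
  ≡⟨ ℤP.+-identityˡ _ ⟩
    c (fsuc t₀)
  ∎
  where open ≡-Reasoning

sumℤ-combination : ∀ {n} (u : Fin n → ℕ → ℤ) (c : Fin n → ℤ) (js : List ℕ) →
  sumℤ (map (λ j → sum (λ t → u t j * c t)) js) ≡ sum (λ t → sumℤ (map (u t) js) * c t)
sumℤ-combination {n} u c [] =
  sym (trans (sum-cong-≗ (λ t → ℤP.*-zeroˡ (c t))) (sum-replicate-zero n))
sumℤ-combination u c (j ∷ js) = begin
    sum (λ t → u t j * c t) + sumℤ (map (λ j → sum (λ t → u t j * c t)) js)
  ≡⟨ cong (_+_ (sum (λ t → u t j * c t))) (sumℤ-combination u c js) ⟩
    sum (λ t → u t j * c t) + sum (λ t → sumℤ (map (u t) js) * c t)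
  ≡⟨ sym (∑-distrib-+ (λ t → u t j * c t) (λ t → sumℤ (map (u t) js) * c t)) ⟩
    sum (λ t → u t j * c t + sumℤ (map (u t) js) * c t)
  ≡⟨ sum-cong-≗ (λ t → sym (ℤP.*-distribʳ-+ (c t) (u t j) _)) ⟩
    sum (λ t → sumℤ (map (u t) (j ∷ js)) * c t)
  ∎
  where open ≡-Reasoning

module Recurrence (k : ℕ) where

  term : (ℤ → ℤ) → ℕ → ℤ
  term s m = headOr0 (hist k s m)

  history : (ℕ → ℤ) → ℕ → List ℤ
  history u m = map u (downFrom (suc m))

  Recurrent : (ℕ → ℤ) → Set
  Recurrent u = ∀ m → k ≤ suc m → u (suc m) ≡ sumℤ (take k (history u m))

  hist≡history : ∀ s m → hist k s m ≡ history (term s) m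
  hist≡history s zero = refl
  hist≡history s (suc m) with suc m ℕ.<? k
  ... | yes _ = cong (s (+ suc m + + 1 - + k) ∷_) (hist≡history s m)
  ... | no _ = cong (sumℤ (take k (hist k s m)) ∷_) (hist≡history s m)

  term-initial : ∀ s m → m < k → term s m ≡ s (+ m + + 1 - + k)
  term-initial s zero m<k = refl
  term-initial s (suc m) m<k with suc m ℕ.<? k
  ... | yes _ = refl
  ... | no m≮k = ⊥-elim (m≮k m<k)

  term-recurrent : ∀ s → Recurrent (term s)
  term-recurrent s m k≤m with suc m ℕ.<? k
  ... | yes m<k = ⊥-elim (ℕP.≤⇒≯ k≤m m<k)
  ... | no _ = cong (λ h → sumℤ (take k h)) (hist≡history s m)

  combination-recurrent : ∀ {n} (u : Fin n → ℕ → ℤ) (c : Fin n → ℤ) →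
    (∀ t → Recurrent (u t)) → Recurrent (λ m → sum (λ t → u t m * c t))
  combination-recurrent u c rec m k≤m = begin
      sum (λ t → u t (suc m) * c t)
    ≡⟨ sum-cong-≗ (λ t → cong (_* c t) (trans (rec t m k≤m) (cong sumℤ (LP.take-map k _)))) ⟩
      sum (λ t → sumℤ (map (u t) (take k (downFrom (suc m)))) * c t)
    ≡⟨ sym (sumℤ-combination u c (take k (downFrom (suc m)))) ⟩
      sumℤ (map (λ j → sum (λ t → u t j * c t)) (take k (downFrom (suc m))))
    ≡⟨ cong sumℤ (sym (LP.take-map k (downFrom (suc m)))) ⟩
      sumℤ (take k (history (λ j → sum (λ t → u t j * c t)) m))
    ∎
    where open ≡-Reasoning

  -- A solution is determined by its first k terms (k ≥ 1).  The invariant is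
  -- that the whole histories agree, since each new term reads the last k.
  recurrent-unique : 0 < k → ∀ u v → Recurrent u → Recurrent v →
    (∀ m → m < k → u m ≡ v m) → ∀ m → u m ≡ v m
  recurrent-unique 0<k u v recu recv initial m = cong headOr0 (histories m)
    where
    histories : ∀ m → history u m ≡ history v m
    histories zero = cong (_∷ []) (initial 0 0<k)
    histories (suc m) with suc m ℕ.<? k
    ... | yes m<k = cong₂ _∷_ (initial (suc m) m<k) (histories m)
    ... | no m≮k = cong₂ _∷_ step (histories m)
      where
      k≤m : k ≤ suc m
      k≤m = ℕP.≮⇒≥ m≮k
      step : u (suc m) ≡ v (suc m)
      step = trans (recu m k≤m)
               (trans (cong (λ h → sumℤ (take k h)) (histories m)) (sym (recv m k≤m)))

-- The initial segment m < k corresponds to the index x = m + 1 - k, and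
-- 1 - x = d + 1 with d = k - 1 - m the "position" selected by fibInit.
initial-index : ∀ {k m} → m < k → + 1 - (+ m + + 1 - + k) ≡ + suc (k ∸ suc m)
initial-index {k} {m} m<k = begin
    + 1 - (+ m + + 1 - + k)
  ≡⟨ cong (λ K → + 1 - (+ m + + 1 - K)) (sym k≡) ⟩
    + 1 - (+ m + + 1 - (+ 1 + (+ m + + d)))
  ≡⟨ arith (+ m) (+ d) ⟩
    + 1 + + d
  ∎
  where
  open ≡-Reasoning
  d = k ∸ suc m
  k≡ : + 1 + (+ m + + d) ≡ + k
  k≡ = trans (cong (_+_ (+ 1)) (sym (ℤP.pos-+ m d))) (cong +_ (ℕP.m+[n∸m]≡n m<k))
  arith : ∀ M D → + 1 - (M + + 1 - (+ 1 + (M + D))) ≡ + 1 + D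
  arith = solve-∀

position-inverse : ∀ {k m} → m < k → k ∸ suc (k ∸ suc m) ≡ m
position-inverse {suc k} (s≤s m≤k) = ℕP.m∸[m∸n]≡n m≤k

fibInit-hit : ∀ {k} (t : Fin k) {z d} → + 1 - z ≡ + suc d → toℕ t ≡ d → fibInit k t z ≡ + 1
fibInit-hit t {z} {d} eq t≡d with ival t ℤ.≟ (+ 1 - z)
... | yes _ = refl
... | no ne = ⊥-elim (ne (trans (cong (λ j → + suc j) t≡d) (sym eq)))

fibInit-miss : ∀ {k} (t : Fin k) {z d} → + 1 - z ≡ + suc d → toℕ t ≢ d → fibInit k t z ≡ + 0
fibInit-miss t {z} {d} eq t≢d with ival t ℤ.≟ (+ 1 - z)
... | yes hit = ⊥-elim (t≢d (ℕP.suc-injective (ℤP.+-injective (trans hit eq))))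
... | no _ = refl

module Basis (k : ℕ) where
  open Recurrence k

  fibTerm : Fin k → ℕ → ℤ
  fibTerm t = term (fibInit k t)

  -- Coordinate t of s: its value s_{-t}, at shifted index k - 1 - t.
  coordinate : (ℤ → ℤ) → Fin k → ℤ
  coordinate s t = term s (k ∸ suc (toℕ t))

  -- On the initial segment the Fibonacci combination reproduces s, because
  -- the Fibonacci values there form a Kronecker delta.
  basis-initial : ∀ s m → m < k → term s m ≡ sum (λ t → fibTerm t m * coordinate s t)
  basis-initial s m m<k = sym (begin
      sum (λ t → fibTerm t m * coordinate s t)
    ≡⟨ sum-select (λ t → fibTerm t m) (coordinate s) t₀
         (trans (term-initial (fibInit k t₀) m m<k) (fibInit-hit t₀ {+ m + + 1 - + k} (initial-index m<k) toℕt₀))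
         (λ t t≢t₀ → trans (term-initial (fibInit k t) m m<k)
            (fibInit-miss t {+ m + + 1 - + k} (initial-index m<k) (λ eq → t≢t₀ (FP.toℕ-injective (trans eq (sym toℕt₀)))))) ⟩
      term s (k ∸ suc (toℕ t₀))
    ≡⟨ cong (λ j → term s (k ∸ suc j)) toℕt₀ ⟩
      term s (k ∸ suc (k ∸ suc m))
    ≡⟨ cong (term s) (position-inverse m<k) ⟩
      term s m
    ∎)
    where
    open ≡-Reasoning
    d<k : k ∸ suc m < k
    d<k = ℕP.∸-monoʳ-< {k} {suc m} {0} (s≤s z≤n) m<k
    t₀ : Fin k
    t₀ = fromℕ< d<k
    toℕt₀ : toℕ t₀ ≡ k ∸ suc m
    toℕt₀ = FP.toℕ-fromℕ< d<k

  basis : 0 < k → ∀ s m → term s m ≡ sum (λ t → fibTerm t m * coordinate s t)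
  basis 0<k s = recurrent-unique 0<k _ _ (term-recurrent s)
    (combination-recurrent fibTerm (coordinate s) (λ t → term-recurrent (fibInit k t)))
    (basis-initial s)

recSeq-term : ∀ k s x m → x + + k - + 1 ≡ + m → recSeq k s x ≡ Recurrence.term k s m
recSeq-term k s x m eq with (x + + k - + 1) ℤ.<? + 0
... | yes neg = ⊥-elim (ℤP.+≮0 (subst (ℤ._< + 0) eq neg))
... | no _ = cong (λ z → headOr0 (hist k s ∣ z ∣)) eq

matrix-index : ∀ {k} N (a : Fin k) →
  + N - ival a + + 1 + + k - + 1 ≡ + (N ℕ.+ (k ∸ suc (toℕ a)))
matrix-index {k} N a = begin
    + N - ival a + + 1 + + k - + 1
  ≡⟨ cong₂ (λ A K → + N - A + + 1 + K - + 1) (ℤP.pos-+ 1 (toℕ a)) (sym k≡) ⟩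
    + N - (+ 1 + + toℕ a) + + 1 + (+ 1 + (+ toℕ a + + d)) - + 1
  ≡⟨ arith (+ N) (+ toℕ a) (+ d) ⟩
    + N + + d
  ≡⟨ sym (ℤP.pos-+ N d) ⟩
    + (N ℕ.+ d)
  ∎
  where
  open ≡-Reasoning
  d = k ∸ suc (toℕ a)
  k≡ : + 1 + (+ toℕ a + + d) ≡ + k
  k≡ = trans (cong (_+_ (+ 1)) (sym (ℤP.pos-+ (toℕ a) d))) (cong +_ (ℕP.m+[n∸m]≡n (FP.toℕ<n a)))
  arith : ∀ N′ A D → N′ - (+ 1 + A) + + 1 + (+ 1 + (A + D)) - + 1 ≡ N′ + D
  arith = solve-∀

lemma2p4 : (k : ℕ) → 2 ≤ k → (n : ℕ) →
    ∀ r i → Ltil k n r i ≡ (Ftil k n ⊗ Ltil k 0) r i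
lemma2p4 k 2≤k n r i = begin
    luc k i x
  ≡⟨ recSeq-term k (lucInit k i) x M (matrix-index n r) ⟩
    term (lucInit k i) M
  ≡⟨ basis (ℕP.<-≤-trans (s≤s z≤n) 2≤k) (lucInit k i) M ⟩
    sum (λ t → fibTerm t M * coordinate (lucInit k i) t)
  ≡⟨ sum-cong-≗ (λ t → sym (cong₂ _*_
       (recSeq-term k (fibInit k t) x M (matrix-index n r))
       (recSeq-term k (lucInit k i) (+ 0 - ival t + + 1) (k ∸ suc (toℕ t)) (matrix-index 0 t)))) ⟩
    sum (λ t → Ftil k n r t * Ltil k 0 t i)
  ≡⟨ sym (sumℤ-allFin (λ t → Ftil k n r t * Ltil k 0 t i)) ⟩
    (Ftil k n ⊗ Ltil k 0) r i
  ∎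
  where
  open ≡-Reasoning
  open Recurrence k using (term)
  open Basis k
  x = + n - ival r + + 1
  M = n ℕ.+ (k ∸ suc (toℕ r))
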